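{- Let $D$ be a finite source-free digraph and let $q\ge 3$ be an integer. Then $D$ contains two disjoint $q$-kernels. In particular, $D$ contains a $q$-kernel of size at most $\frac{1}{2}|V(D)|$.
   Context: A digraph is source-free if every vertex has in-degree at least $1$. A set $S$ of vertices is independent if there are no arcs between two vertices of $S$. For vertices $u,v$, $\mathrm{dist}(u,v)$ is the length of a shortest directed path from $u$ to $v$, and $\mathrm{dist}(S,v)=\min_{u\in S}\mathrm{dist}(u,v)$. For an integer $q\ge 1$, a $q$-kernel of $D$ is an independent set $Q\subseteq V(D)$ with $\mathrm{dist}(Q,v)\le q$ for every $v\in V(D)$. -}

module Defs where

open import Data.Nat using (ℕ; zero; suc; _≤_; _*_)
open import Data.Fin using (Fin)
open import Data.Fin.Subset using (Subset; _∈_; _∉_; Empty; _∩_; ∣_∣)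
open import Data.Product using (Σ; ∃; ∃-syntax; _×_; _,_)
open import Relation.Nullary using (¬_; Dec)
open import Relation.Binary.PropositionalEquality using (_≡_)

-- A finite digraph on vertex set Fin n: a decidable arc relation without loops
-- (no parallel arcs by construction).
record Digraph (n : ℕ) : Set₁ where
  field
    Arc     : Fin n → Fin n → Set
    arc?    : ∀ u v → Dec (Arc u v)
    loopless : ∀ v → ¬ Arc v v
open Digraph public

SourceFree : ∀ {n} → Digraph n → Set
SourceFree {n} D = ∀ (v : Fin n) → ∃[ u ] Arc D u v

data Walk {n} (D : Digraph n) : Fin n → Fin n → ℕ → Set where
  [] : ∀ {u} → Walk D u u zero
  _∷_ : ∀ {u w v k} → Arc D u w → Walk D w v k → Walk D u v (suc k)

-- dist(u,v) ≤ k  iff  there is a directed walk (equivalently path) of length ≤ k.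
DistLe : ∀ {n} → Digraph n → Fin n → Fin n → ℕ → Set
DistLe D u v k = ∃[ l ] (l ≤ k × Walk D u v l)

DistSetLe : ∀ {n} → Digraph n → Subset n → Fin n → ℕ → Set
DistSetLe D S v k = ∃[ u ] (u ∈ S × DistLe D u v k)

Independent : ∀ {n} → Digraph n → Subset n → Set
Independent D S = ∀ u v → u ∈ S → v ∈ S → ¬ Arc D u v

IsKernel : ∀ {n} → Digraph n → ℕ → Subset n → Set
IsKernel {n} D q Q = Independent D Q × (∀ (v : Fin n) → DistSetLe D Q v q)

Disjoint : ∀ {n} → Subset n → Subset n → Set
Disjoint S T = Empty (S ∩ T)

-- Every vertex set U contains an independent set Q from which each vertex of U
-- is at distance at most 2 (Chvátal–Lovász): greedily, take the first vertex v
-- of U, discard v and its out-neighbours, recurse, and add v to the result unless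
-- it already has an in-neighbour there.  Let Q₁ be such a set for all of V(D)
-- and Q₂ one for V(D) ∖ Q₁.  A vertex v ∈ Q₁ has an in-neighbour x, and x ∉ Q₁
-- by independence, so dist(Q₂, v) ≤ dist(Q₂, x) + 1 ≤ 3.  Of the two disjoint
-- kernels Q₁, Q₂ the smaller has at most |V(D)|/2 vertices.
module Submission where

open import Defs
open import Data.Nat using (ℕ; suc; _≤_; _*_; _+_; _∸_; z≤n; s≤s)
open import Data.Nat.Properties
  using (≤-trans; ≤-total; ≤-refl; +-identityʳ; +-comm; +-monoʳ-≤; ≤-reflexive; m+[n∸m]≡n; module ≤-Reasoning)
open import Data.Fin using (Fin; _≟_)
open import Data.Fin.Properties using (any?)
open import Data.Fin.Subset using (Subset; ∣_∣; _∈_; _∉_; _⊆_; ⁅_⁆; _∪_; ⊥; ⊤; ∁)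
open import Data.Fin.Subset.Properties
  using (_∈?_; ∉⊥; ∈⊤; x∈⁅x⁆; x∈⁅y⁆⇒x≡y; x∈p∪q⁻; x∈p∪q⁺; x∈p∩q⁺; x∈p∩q⁻;
         x∈∁p⇒x∉p; x∉p⇒x∈∁p; p⊆q⇒∣p∣≤∣q∣; ∣∁p∣≡n∸∣p∣; ∣p∣≤n)
open import Data.List using (List; []; _∷_; length; filter; allFin)
open import Data.List.Properties using (length-filter)
open import Data.List.Membership.Propositional using () renaming (_∈_ to _∈ᴸ_)
open import Data.List.Membership.Propositional.Properties using (∈-filter⁺; ∈-filter⁻; ∈-allFin)
open import Data.List.Relation.Unary.Any using (here; there)
open import Data.Product using (∃; ∃-syntax; _×_; _,_; proj₁; proj₂)
open import Data.Sum using (_⊎_; inj₁; inj₂; map₁)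
open import Data.Empty using (⊥-elim)
open import Function using (_∘_)
open import Relation.Nullary using (¬_; Dec; yes; no; ¬?)
open import Relation.Nullary.Decidable using (_⊎-dec_; _×-dec_)
open import Relation.Binary.PropositionalEquality using (_≡_; refl; cong)

module _ {n} (D : Digraph n) where

  _∷ʳ_ : ∀ {u w v k} → Walk D u w k → Arc D w v → Walk D u v (suc k)
  []      ∷ʳ a = a ∷ []
  (b ∷ p) ∷ʳ a = b ∷ (p ∷ʳ a)

  distSetLe-refl : ∀ {Q x} → x ∈ Q → DistSetLe D Q x 0
  distSetLe-refl {x = x} x∈Q = x , x∈Q , 0 , z≤n , []

  distSetLe-mono-≤ : ∀ {Q u k k′} → k ≤ k′ → DistSetLe D Q u k → DistSetLe D Q u k′
  distSetLe-mono-≤ k≤k′ (x , x∈Q , l , l≤k , p) = x , x∈Q , l , ≤-trans l≤k k≤k′ , p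

  distSetLe-mono-⊆ : ∀ {Q R u k} → Q ⊆ R → DistSetLe D Q u k → DistSetLe D R u k
  distSetLe-mono-⊆ Q⊆R (x , x∈Q , d) = x , Q⊆R x∈Q , d

  distSetLe-step : ∀ {Q u v k} → DistSetLe D Q u k → Arc D u v → DistSetLe D Q v (suc k)
  distSetLe-step (x , x∈Q , l , l≤k , p) a = x , x∈Q , suc l , s≤s l≤k , p ∷ʳ a

  N⁺[_] : Fin n → Fin n → Set
  N⁺[ v ] u = Arc D v u ⊎ u ≡ v

  N⁺[_]? : ∀ v u → Dec (N⁺[ v ] u)
  N⁺[ v ]? u = arc? D v u ⊎-dec (u ≟ v)

  distSetLe-N⁺ : ∀ {Q v u} → DistSetLe D Q v 1 → N⁺[ v ] u → DistSetLe D Q u 2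
  distSetLe-N⁺ d (inj₁ a)    = distSetLe-step d a
  distSetLe-N⁺ d (inj₂ refl) = distSetLe-mono-≤ (s≤s z≤n) d

  independent-insert : ∀ {Q v} → Independent D Q →
    (∀ {w} → w ∈ Q → ¬ Arc D w v) → (∀ {w} → w ∈ Q → ¬ Arc D v w) →
    Independent D (⁅ v ⁆ ∪ Q)
  independent-insert {Q} {v} indQ ¬into ¬out x y x∈ y∈
    with x∈p∪q⁻ ⁅ v ⁆ Q x∈ | x∈p∪q⁻ ⁅ v ⁆ Q y∈
  ... | inj₁ x∈⁅v⁆ | inj₁ y∈⁅v⁆
    rewrite x∈⁅y⁆⇒x≡y v x∈⁅v⁆ | x∈⁅y⁆⇒x≡y v y∈⁅v⁆ = loopless D v
  ... | inj₁ x∈⁅v⁆ | inj₂ y∈Q rewrite x∈⁅y⁆⇒x≡y v x∈⁅v⁆ = ¬out y∈Q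
  ... | inj₂ x∈Q  | inj₁ y∈⁅v⁆ rewrite x∈⁅y⁆⇒x≡y v y∈⁅v⁆ = ¬into x∈Q
  ... | inj₂ x∈Q  | inj₂ y∈Q  = indQ x y x∈Q y∈Q

  -- Q is a quasi-kernel of the converse digraph, relative to the vertices satisfying P.
  record IsQuasiKernelOf (P : Fin n → Set) (Q : Subset n) : Set where
    field
      independent : Independent D Q
      ⊆P          : ∀ {x} → x ∈ Q → P x
      dominates   : ∀ {u} → P u → DistSetLe D Q u 2
  open IsQuasiKernelOf

  isQuasiKernelOf-resp : ∀ {P P′ Q} → (∀ {x} → P x → P′ x) → (∀ {x} → P′ x → P x) →
    IsQuasiKernelOf P Q → IsQuasiKernelOf P′ Q
  isQuasiKernelOf-resp P⇒P′ P′⇒P K = record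
    { independent = independent K
    ; ⊆P          = P⇒P′ ∘ ⊆P K
    ; dominates   = dominates K ∘ P′⇒P
    }

  private
    Outside : Fin n → List (Fin n) → List (Fin n)
    Outside v = filter (¬? ∘ N⁺[ v ]?)

    quasiKernelOf-∷ : ∀ {v L Q′ Q} → IsQuasiKernelOf (_∈ᴸ Outside v L) Q′ →
      Q′ ⊆ Q → Independent D Q → (∀ {x} → x ∈ Q → x ≡ v ⊎ x ∈ Q′) →
      DistSetLe D Q v 1 → IsQuasiKernelOf (_∈ᴸ v ∷ L) Q
    quasiKernelOf-∷ {v} {L} {Q′} {Q} K Q′⊆Q indQ Q⊆v∪Q′ dv = record
      { independent = indQ
      ; ⊆P          = Q⊆v∷L
      ; dominates   = dom
      }
      where
      Q⊆v∷L : ∀ {x} → x ∈ Q → x ∈ᴸ v ∷ L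
      Q⊆v∷L x∈Q with Q⊆v∪Q′ x∈Q
      ... | inj₁ x≡v  = here x≡v
      ... | inj₂ x∈Q′ = there (proj₁ (∈-filter⁻ (¬? ∘ N⁺[ v ]?) {xs = L} (⊆P K x∈Q′)))
      dom : ∀ {u} → u ∈ᴸ v ∷ L → DistSetLe D Q u 2
      dom (here refl) = distSetLe-mono-≤ (s≤s z≤n) dv
      dom {u} (there u∈L) with N⁺[ v ]? u
      ... | yes u∈N⁺ = distSetLe-N⁺ dv u∈N⁺
      ... | no  u∉N⁺ = distSetLe-mono-⊆ Q′⊆Q (dominates K (∈-filter⁺ (¬? ∘ N⁺[ v ]?) u∈L u∉N⁺))

  quasiKernelOfList : ∀ fuel (L : List (Fin n)) → length L ≤ fuel → ∃ (IsQuasiKernelOf (_∈ᴸ L))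
  quasiKernelOfList _ [] _ = ⊥ , record
    { independent = λ _ _ x∈⊥ → ⊥-elim (∉⊥ x∈⊥)
    ; ⊆P          = ⊥-elim ∘ ∉⊥
    ; dominates   = λ ()
    }
  quasiKernelOfList (suc fuel) (v ∷ L) (s≤s |L|≤fuel)
    with quasiKernelOfList fuel (Outside v L) (≤-trans (length-filter (¬? ∘ N⁺[ v ]?) L) |L|≤fuel)
  ... | Q′ , K with any? (λ w → w ∈? Q′ ×-dec arc? D w v)
  ...   | yes (w , w∈Q′ , a) =
          Q′ , quasiKernelOf-∷ K (λ x∈ → x∈) (independent K) inj₂ (distSetLe-step (distSetLe-refl w∈Q′) a)
  ...   | no ¬into =
          ⁅ v ⁆ ∪ Q′ , quasiKernelOf-∷ K (x∈p∪q⁺ ∘ inj₂) ind split (distSetLe-mono-≤ z≤n (distSetLe-refl v∈))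
    where
    ¬out : ∀ {w} → w ∈ Q′ → ¬ Arc D v w
    ¬out w∈Q′ a = proj₂ (∈-filter⁻ (¬? ∘ N⁺[ v ]?) {xs = L} (⊆P K w∈Q′)) (inj₁ a)
    ind : Independent D (⁅ v ⁆ ∪ Q′)
    ind = independent-insert (independent K) (λ {w} w∈Q′ a → ¬into (w , w∈Q′ , a)) ¬out
    split : ∀ {x} → x ∈ ⁅ v ⁆ ∪ Q′ → x ≡ v ⊎ x ∈ Q′
    split x∈ = map₁ (x∈⁅y⁆⇒x≡y v) (x∈p∪q⁻ ⁅ v ⁆ Q′ x∈)
    v∈ : v ∈ ⁅ v ⁆ ∪ Q′
    v∈ = x∈p∪q⁺ (inj₁ (x∈⁅x⁆ v))

  quasiKernelOf : (U : Subset n) → ∃ (IsQuasiKernelOf (_∈ U))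
  quasiKernelOf U = let Q , K = quasiKernelOfList (length L) L ≤-refl in
    Q , isQuasiKernelOf-resp (λ x∈L → proj₂ (∈-filter⁻ (_∈? U) {xs = allFin n} x∈L))
                             (λ {x} → ∈-filter⁺ (_∈? U) (∈-allFin x)) K
    where
    L : List (Fin n)
    L = filter (_∈? U) (allFin n)

  sourceFree⇒distSetLe-3 : ∀ {Q₁ Q₂} → SourceFree D → Independent D Q₁ →
    (∀ {u} → u ∉ Q₁ → DistSetLe D Q₂ u 2) → ∀ v → DistSetLe D Q₂ v 3
  sourceFree⇒distSetLe-3 {Q₁} sf indQ₁ dom v with v ∈? Q₁ | sf v
  ... | no  v∉Q₁ | _     = distSetLe-mono-≤ (s≤s (s≤s z≤n)) (dom v∉Q₁)
  ... | yes v∈Q₁ | x , a = distSetLe-step (dom (λ x∈Q₁ → indQ₁ x v x∈Q₁ v∈Q₁ a)) a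

module _ {n : ℕ} {p q : Subset n} where

  Disjoint⇒⊆∁ : Disjoint p q → q ⊆ ∁ p
  Disjoint⇒⊆∁ p∩q≡∅ x∈q = x∉p⇒x∈∁p (λ x∈p → p∩q≡∅ (_ , x∈p∩q⁺ (x∈p , x∈q)))

  ⊆∁⇒Disjoint : q ⊆ ∁ p → Disjoint p q
  ⊆∁⇒Disjoint q⊆∁p (x , x∈p∩q) = let x∈p , x∈q = x∈p∩q⁻ p q x∈p∩q in x∈∁p⇒x∉p (q⊆∁p x∈q) x∈p

  ∣p∣+∣q∣≤n : Disjoint p q → ∣ p ∣ + ∣ q ∣ ≤ n
  ∣p∣+∣q∣≤n p∩q≡∅ = begin
    ∣ p ∣ + ∣ q ∣        ≤⟨ +-monoʳ-≤ ∣ p ∣ (p⊆q⇒∣p∣≤∣q∣ (Disjoint⇒⊆∁ p∩q≡∅)) ⟩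
    ∣ p ∣ + ∣ ∁ p ∣      ≡⟨ cong (∣ p ∣ +_) (∣∁p∣≡n∸∣p∣ p) ⟩
    ∣ p ∣ + (n ∸ ∣ p ∣)  ≡⟨ m+[n∸m]≡n (∣p∣≤n p) ⟩
    n                    ∎
    where open ≤-Reasoning

2*m≤n : ∀ {m k n} → m ≤ k → m + k ≤ n → 2 * m ≤ n
2*m≤n {m} {k} {n} m≤k m+k≤n = begin
  2 * m      ≡⟨ cong (m +_) (+-identityʳ m) ⟩
  m + m      ≤⟨ +-monoʳ-≤ m m≤k ⟩
  m + k      ≤⟨ m+k≤n ⟩
  n          ∎
  where open ≤-Reasoning

smaller-of-disjoint : ∀ {n} {P : Subset n → Set} {p q} → P p → P q → Disjoint p q →
  ∃[ r ] (P r × 2 * ∣ r ∣ ≤ n)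
smaller-of-disjoint {p = p} {q} Pp Pq p∩q≡∅ with ≤-total ∣ p ∣ ∣ q ∣
... | inj₁ ∣p∣≤∣q∣ = p , Pp , 2*m≤n ∣p∣≤∣q∣ (∣p∣+∣q∣≤n p∩q≡∅)
... | inj₂ ∣q∣≤∣p∣ = q , Pq , 2*m≤n ∣q∣≤∣p∣ (≤-trans (≤-reflexive (+-comm ∣ q ∣ ∣ p ∣)) (∣p∣+∣q∣≤n p∩q≡∅))

proposition2p2 : ∀ {n} (D : Digraph n) (q : ℕ) → SourceFree D → 3 ≤ q →
    (∃[ Q₁ ] ∃[ Q₂ ] (IsKernel D q Q₁ × IsKernel D q Q₂ × Disjoint Q₁ Q₂))
    × (∃[ Q ] (IsKernel D q Q × 2 * ∣ Q ∣ ≤ n))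
proposition2p2 {n} D q sourceFree 3≤q =
  (Q₁ , Q₂ , kernel₁ , kernel₂ , Q₁∩Q₂≡∅) , smaller-of-disjoint kernel₁ kernel₂ Q₁∩Q₂≡∅
  where
  open IsQuasiKernelOf
  Q₁ : Subset n
  Q₁ = proj₁ (quasiKernelOf D ⊤)
  K₁ : IsQuasiKernelOf D (_∈ ⊤) Q₁
  K₁ = proj₂ (quasiKernelOf D ⊤)
  Q₂ : Subset n
  Q₂ = proj₁ (quasiKernelOf D (∁ Q₁))
  K₂ : IsQuasiKernelOf D (_∈ ∁ Q₁) Q₂
  K₂ = proj₂ (quasiKernelOf D (∁ Q₁))
  kernel₁ : IsKernel D q Q₁
  kernel₁ = independent K₁ , λ v → distSetLe-mono-≤ D (≤-trans (s≤s (s≤s z≤n)) 3≤q) (dominates K₁ ∈⊤)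
  kernel₂ : IsKernel D q Q₂
  kernel₂ = independent K₂ ,
    λ v → distSetLe-mono-≤ D 3≤q (sourceFree⇒distSetLe-3 D sourceFree (independent K₁) (dominates K₂ ∘ x∉p⇒x∈∁p) v)
  Q₁∩Q₂≡∅ : Disjoint Q₁ Q₂
  Q₁∩Q₂≡∅ = ⊆∁⇒Disjoint (⊆P K₂)
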